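{- Let $g^{ -1}$ be the Dirichlet inverse of the arithmetic function $g(n)=\omega(n)+1$. Then $\operatorname{sgn}(g^{ -1}(n))=\lambda(n)$ for all $n\ge 1$.
   Context: $\omega(n)$ is the number of distinct prime divisors of $n$ ($\omega(1)=0$); $\lambda(n)=(-1)^{\Omega(n)}$ is the Liouville function, where $\Omega(n)$ counts prime divisors with multiplicity. For an arithmetic function $r$, $\operatorname{sgn}(r(n))=r(n)/(|r(n)|+[r(n)=0])\in\{0,\pm1\}$. The Dirichlet inverse $g^{ -1}$ satisfies $\sum_{d\mid n}g(d)g^{ -1}(n/d)=1$ if $n=1$ and $0$ otherwise. -}

module Defs where

open import Data.Nat as ℕ using (ℕ; zero; suc; _^_; _/_)
open import Data.Nat.Divisibility using (_∣_; _∣?_)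
open import Data.Nat.Primality using (Prime; prime?)
open import Data.Integer as ℤ using (ℤ; +_; -[1+_]; +[1+_])
open import Data.List using (List; []; _∷_; _++_; filter; length; map; foldr)
open import Relation.Nullary using (yes; no)
open import Relation.Binary.PropositionalEquality using (_≡_)
open import Relation.Nullary.Decidable using (_×-dec_)
open import Data.Product using (_×_)

range1 : ℕ → List ℕ
range1 zero = []
range1 (suc n) = range1 n ++ (suc n ∷ [])

-- ω(n): number of distinct primes p (necessarily p ≤ n for n ≥ 1) dividing n
ω : ℕ → ℕ
ω n = length (filter (λ p → prime? p ×-dec p ∣? n) (range1 n))

-- v_p(n) for n ≥ 1: number of k ∈ {1..n} with p^k ∣ n
val : ℕ → ℕ → ℕ
val p n = length (filter (λ k → (p ^ k) ∣? n) (range1 n))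

Ω : ℕ → ℕ
Ω n = foldr ℕ._+_ 0 (map (λ p → val p n) (filter (λ p → prime? p ×-dec p ∣? n) (range1 n)))

liouville : ℕ → ℤ
liouville n = (ℤ.- ℤ.1ℤ) ℤ.^ Ω n

sgn : ℤ → ℤ
sgn (+ zero) = ℤ.0ℤ
sgn +[1+ _ ] = ℤ.1ℤ
sgn -[1+ _ ] = ℤ.-1ℤ

dirichlet : (ℕ → ℤ) → (ℕ → ℤ) → ℕ → ℤ
dirichlet f h n =
  foldr ℤ._+_ ℤ.0ℤ (map term (range1 n))
  where
  term : ℕ → ℤ
  term zero = ℤ.0ℤ
  term (suc i) with suc i ∣? n
  ... | yes _ = f (suc i) ℤ.* h (n / suc i)
  ... | no _ = ℤ.0ℤ

unitε : ℕ → ℤ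
unitε 1 = ℤ.1ℤ
unitε _ = ℤ.0ℤ

g : ℕ → ℤ
g n = + (ω n ℕ.+ 1)

IsDirichletInverse : (ℕ → ℤ) → (ℕ → ℤ) → Set
IsDirichletInverse f finv = ∀ n → 1 ℕ.≤ n → dirichlet f finv n ≡ unitε n

{-# OPTIONS --safe #-}
module Submission where

-- Since g = (ε + 1_prime) ⋆ 1, the function μ = g⁻¹ ⋆ (ε + 1_prime) satisfies μ ⋆ 1 = ε: it is the
-- Möbius function, and g⁻¹(n) = μ(n) − Σ_{p ∣ n} g⁻¹(n/p). As λ(n) = −λ(n/p) for p ∣ n,
--   λ(n) g⁻¹(n) = λ(n) μ(n) + Σ_{p ∣ n} λ(n/p) g⁻¹(n/p).
-- Here λμ ≥ 0 and λ(1)μ(1) = 1, so strong induction gives λ(n) g⁻¹(n) ≥ 1, whence sgn g⁻¹(n) = λ(n).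
-- That λμ ≥ 0 is shown prime by prime, avoiding multiplicativity: for P ∣ n, writing
-- μ = μ′ ⋆ (ε − δ_P) with μ′ vanishing on multiples of P gives μ(n) ∈ {0, −μ(n/P)}.

open import Defs
open import Data.Nat using (ℕ; _≤_)
open import Data.Integer using (ℤ)
open import Relation.Binary.PropositionalEquality using (_≡_)

open import Data.Nat as ℕ using (zero; suc; NonZero; _<_; z≤n; s≤s; _≟_; _<?_; _*_; _/_; _^_)
import Data.Nat.Properties as ℕP
import Data.Integer.Properties as ℤP
import Data.Nat.DivMod as DM
open import Data.Nat.Divisibility
  using (_∣_; _∣?_; divides; ∣⇒≤; 1∣_; ∣1⇒≡1; ∣-refl; ∣-trans; m∣m*n; ∣m⇒∣m*n; *-cancelʳ-∣; *-monoˡ-∣)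
open import Data.Nat.Coprimality using (Coprime; coprime-divisor)
open import Data.Nat.Primality using (Prime; prime?; prime⇒nonTrivial; prime⇒irreducible; ¬prime⇒composite; euclidsLemma)
open import Data.Nat.Divisibility.Core using (hasNonTrivialDivisor)
open import Data.List using (List; []; _∷_; _++_; foldr; map; filter; length)
open import Data.List.Properties using (map-++; filter-++)
open import Data.Nat.ListAction using (sum)
open import Data.Nat.ListAction.Properties using (sum-++)
open import Relation.Unary using (Decidable)
open import Data.Integer as ℤ
  using (+_; 0ℤ; 1ℤ; -1ℤ; +[1+_]; -[1+_]; +≤+)
  renaming (_+_ to _+ᶻ_; _*_ to _*ᶻ_; -_ to -ᶻ_; _≤_ to _≤ᶻ_)
open import Algebra.Properties.CommutativeSemigroup ℤP.+-commutativeSemigroup using (interchange)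
open import Data.Empty using (⊥-elim)
open import Data.Integer.Tactic.RingSolver using (solve-∀)
open import Data.Product using (Σ; _×_; _,_; proj₁; proj₂; uncurry)
open import Function using (_∘_; id; flip)
open import Data.Sum using (_⊎_; inj₁; inj₂; [_,_]′)
open import Data.Nat.Induction using (<-rec)
open import Relation.Binary.PropositionalEquality using (refl; sym; trans; cong; cong₂; subst; _≢_; module ≡-Reasoning)
open import Relation.Nullary using (Dec; yes; no; ¬_; ¬?)
open import Relation.Nullary.Decidable using (_×-dec_)

-- Iverson brackets and finite sums

when : {P : Set} → Dec P → ℤ → ℤ
when (yes _) x = x
when (no _)  _ = 0ℤ

module _ {P : Set} where

  when-yes : ∀ {x} → P → (d : Dec P) → when d x ≡ x
  when-yes p (yes _) = refl
  when-yes p (no ¬p) = ⊥-elim (¬p p)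

  when-no : ∀ {x} → ¬ P → (d : Dec P) → when d x ≡ 0ℤ
  when-no ¬p (yes p) = ⊥-elim (¬p p)
  when-no ¬p (no _)  = refl

  when-cong : ∀ {x y} (d : Dec P) → (P → x ≡ y) → when d x ≡ when d y
  when-cong (yes p) x≡y = x≡y p
  when-cong (no _)  _   = refl

  when-zero : (d : Dec P) → when d 0ℤ ≡ 0ℤ
  when-zero (yes _) = refl
  when-zero (no _)  = refl

  when-*ʳ : (d : Dec P) → ∀ x y → when d x *ᶻ y ≡ when d (x *ᶻ y)
  when-*ʳ (yes _) x y = refl
  when-*ʳ (no _)  x y = refl

  when-*ˡ : (d : Dec P) → ∀ x y → y *ᶻ when d x ≡ when d (y *ᶻ x)
  when-*ˡ (yes _) x y = refl
  when-*ˡ (no _)  x y = ℤP.*-zeroʳ y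

  when-+ : (d : Dec P) → ∀ x y → when d (x +ᶻ y) ≡ when d x +ᶻ when d y
  when-+ (yes _) x y = refl
  when-+ (no _)  x y = refl

  when-neg : (d : Dec P) → ∀ x → when d (-ᶻ x) ≡ -ᶻ when d x
  when-neg (yes _) x = refl
  when-neg (no _)  x = refl

  when-nonNeg : (d : Dec P) → ∀ {x} → (P → 0ℤ ≤ᶻ x) → 0ℤ ≤ᶻ when d x
  when-nonNeg (yes p) 0≤x = 0≤x p
  when-nonNeg (no _)  _   = ℤP.≤-refl

module _ {P Q : Set} where

  when-⇔ : ∀ {x} → (P → Q) → (Q → P) → (dP : Dec P) (dQ : Dec Q) → when dP x ≡ when dQ x
  when-⇔ P⇒Q Q⇒P (yes p) dQ = sym (when-yes (P⇒Q p) dQ)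
  when-⇔ P⇒Q Q⇒P (no ¬p) dQ = sym (when-no (¬p ∘ Q⇒P) dQ)

  when-comm : (dP : Dec P) (dQ : Dec Q) → ∀ x → when dP (when dQ x) ≡ when dQ (when dP x)
  when-comm (yes _) dQ      x = refl
  when-comm (no _)  (yes _) x = refl
  when-comm (no _)  (no _)  x = refl

  when-× : (dP : Dec P) (dQ : Dec Q) → ∀ x → when (dP ×-dec dQ) x ≡ when dP (when dQ x)
  when-× (yes _) (yes _) x = refl
  when-× (yes _) (no _)  x = refl
  when-× (no _)  (yes _) x = refl
  when-× (no _)  (no _)  x = refl

  when-redundant : (Q → P) → (dP : Dec P) (dQ : Dec Q) → ∀ x → when dP (when dQ x) ≡ when dQ x
  when-redundant Q⇒P dP (yes q) x = when-yes (Q⇒P q) dP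
  when-redundant Q⇒P dP (no _)  x = when-zero dP

Σ< : ℕ → (ℕ → ℤ) → ℤ
Σ< zero    f = 0ℤ
Σ< (suc N) f = Σ< N f +ᶻ f N

Σ<-cong : ∀ N {f h : ℕ → ℤ} → (∀ i → i < N → f i ≡ h i) → Σ< N f ≡ Σ< N h
Σ<-cong zero    f≡h = refl
Σ<-cong (suc N) f≡h = cong₂ _+ᶻ_ (Σ<-cong N (λ i i<N → f≡h i (ℕP.m<n⇒m<1+n i<N))) (f≡h N ℕP.≤-refl)

Σ<-zero : ∀ N {f : ℕ → ℤ} → (∀ i → i < N → f i ≡ 0ℤ) → Σ< N f ≡ 0ℤ
Σ<-zero zero    f≡0 = refl
Σ<-zero (suc N) f≡0 = cong₂ _+ᶻ_ (Σ<-zero N (λ i i<N → f≡0 i (ℕP.m<n⇒m<1+n i<N))) (f≡0 N ℕP.≤-refl)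

Σ<-distrib-+ : ∀ N (f h : ℕ → ℤ) → Σ< N (λ i → f i +ᶻ h i) ≡ Σ< N f +ᶻ Σ< N h
Σ<-distrib-+ zero    f h = refl
Σ<-distrib-+ (suc N) f h = trans (cong (_+ᶻ (f N +ᶻ h N)) (Σ<-distrib-+ N f h))
                                 (interchange (Σ< N f) (Σ< N h) (f N) (h N))

Σ<-neg : ∀ N (f : ℕ → ℤ) → Σ< N (λ i → -ᶻ f i) ≡ -ᶻ Σ< N f
Σ<-neg zero    f = refl
Σ<-neg (suc N) f = trans (cong (_+ᶻ -ᶻ f N) (Σ<-neg N f)) (sym (ℤP.neg-distrib-+ (Σ< N f) (f N)))

*-distribˡ-Σ< : ∀ N c (f : ℕ → ℤ) → c *ᶻ Σ< N f ≡ Σ< N (λ i → c *ᶻ f i)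
*-distribˡ-Σ< zero    c f = ℤP.*-zeroʳ c
*-distribˡ-Σ< (suc N) c f = trans (ℤP.*-distribˡ-+ c (Σ< N f) (f N)) (cong (_+ᶻ c *ᶻ f N) (*-distribˡ-Σ< N c f))

*-distribʳ-Σ< : ∀ N c (f : ℕ → ℤ) → Σ< N f *ᶻ c ≡ Σ< N (λ i → f i *ᶻ c)
*-distribʳ-Σ< N c f = trans (ℤP.*-comm (Σ< N f) c)
  (trans (*-distribˡ-Σ< N c f) (Σ<-cong N (λ i _ → ℤP.*-comm c (f i))))

when-Σ< : ∀ {P : Set} (d : Dec P) N (f : ℕ → ℤ) → when d (Σ< N f) ≡ Σ< N (λ i → when d (f i))
when-Σ< (yes _) N f = refl
when-Σ< (no _)  N f = sym (Σ<-zero N (λ _ _ → refl))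

Σ<-suc : ∀ N (f : ℕ → ℤ) → Σ< (suc N) f ≡ f 0 +ᶻ Σ< N (f ∘ suc)
Σ<-suc zero    f = ℤP.+-comm 0ℤ (f 0)
Σ<-suc (suc N) f = trans (cong (_+ᶻ f (suc N)) (Σ<-suc N f)) (ℤP.+-assoc (f 0) _ _)

Σ<-comm : ∀ N M (f : ℕ → ℕ → ℤ) → Σ< N (λ i → Σ< M (f i)) ≡ Σ< M (λ j → Σ< N (λ i → f i j))
Σ<-comm zero    M f = sym (Σ<-zero M (λ _ _ → refl))
Σ<-comm (suc N) M f = trans (cong (_+ᶻ Σ< M (f N)) (Σ<-comm N M f))
                            (sym (Σ<-distrib-+ M (λ j → Σ< N (λ i → f i j)) (f N)))

Σ<-δ : ∀ N k (f : ℕ → ℤ) → Σ< N (λ i → when (i ≟ k) (f i)) ≡ when (k <? N) (f k)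
Σ<-δ zero    k f = sym (when-no {x = f k} (λ ()) (k <? 0))
Σ<-δ (suc N) k f with N ≟ k
... | yes refl = trans (cong (_+ᶻ f N) (trans (Σ<-δ N N f) (when-no (ℕP.<-irrefl refl) (N <? N))))
                       (trans (ℤP.+-identityˡ (f N)) (sym (when-yes ℕP.≤-refl (N <? suc N))))
... | no N≢k = trans (trans (ℤP.+-identityʳ _) (Σ<-δ N k f))
                     (when-⇔ ℕP.m<n⇒m<1+n (λ k<1+N → ℕP.≤∧≢⇒< (ℕP.≤-pred k<1+N) (N≢k ∘ sym)) (k <? N) (k <? suc N))

Σ<-zero-tail : ∀ N M (f : ℕ → ℤ) → N ≤ M → (∀ i → N ≤ i → i < M → f i ≡ 0ℤ) → Σ< M f ≡ Σ< N f
Σ<-zero-tail N zero    f z≤n  _ = refl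
Σ<-zero-tail N (suc M) f N≤1+M tail≡0 with N ≟ suc M
... | yes refl = refl
... | no N≢1+M = trans (cong₂ _+ᶻ_ (Σ<-zero-tail N M f N≤M (λ i N≤i i<M → tail≡0 i N≤i (ℕP.m<n⇒m<1+n i<M)))
                                   (tail≡0 M N≤M ℕP.≤-refl))
                       (ℤP.+-identityʳ _)
  where N≤M = ℕP.≤-pred (ℕP.≤∧≢⇒< N≤1+M N≢1+M)

Σ<-nonNeg : ∀ N (f : ℕ → ℤ) → (∀ i → i < N → 0ℤ ≤ᶻ f i) → 0ℤ ≤ᶻ Σ< N f
Σ<-nonNeg zero    f f≥0 = ℤP.≤-refl
Σ<-nonNeg (suc N) f f≥0 = ℤP.+-mono-≤ (Σ<-nonNeg N f (λ i i<N → f≥0 i (ℕP.m<n⇒m<1+n i<N))) (f≥0 N ℕP.≤-refl)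

term≤Σ< : ∀ N k (f : ℕ → ℤ) → k < N → (∀ i → i < N → 0ℤ ≤ᶻ f i) → f k ≤ᶻ Σ< N f
term≤Σ< (suc N) k f k<1+N f≥0 with k ≟ N
... | yes refl = subst (_≤ᶻ Σ< (suc N) f) (ℤP.+-identityˡ (f N))
                       (ℤP.+-mono-≤ (Σ<-nonNeg N f f≥0′) ℤP.≤-refl)
  where f≥0′ = λ i i<N → f≥0 i (ℕP.m<n⇒m<1+n i<N)
... | no k≢N = subst (_≤ᶻ Σ< (suc N) f) (ℤP.+-identityʳ (f k))
                     (ℤP.+-mono-≤ (term≤Σ< N k f (ℕP.≤∧≢⇒< (ℕP.≤-pred k<1+N) k≢N) f≥0′) (f≥0 N ℕP.≤-refl))
  where f≥0′ = λ i i<N → f≥0 i (ℕP.m<n⇒m<1+n i<N)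

-- Dirichlet convolution

*≡⇒boundsˡ : ∀ a b n → a * b ≡ n → 1 ≤ n → 1 ≤ a × a ≤ n
*≡⇒boundsˡ zero    b       n ab≡n 1≤n = ⊥-elim (ℕP.<-irrefl ab≡n 1≤n)
*≡⇒boundsˡ (suc a) zero    n ab≡n 1≤n = ⊥-elim (ℕP.<-irrefl (trans (sym (ℕP.*-zeroʳ a)) ab≡n) 1≤n)
*≡⇒boundsˡ (suc a) (suc b) n ab≡n 1≤n = s≤s z≤n , subst (suc a ≤_) ab≡n (ℕP.m≤m*n (suc a) (suc b))

*≡⇒boundsʳ : ∀ a b n → a * b ≡ n → 1 ≤ n → 1 ≤ b × b ≤ n
*≡⇒boundsʳ a b n ab≡n = *≡⇒boundsˡ b a n (trans (ℕP.*-comm b a) ab≡n)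

infixl 7 _⋆_

-- Meaningful for n ≥ 1 only; then the terms with a = 0 or b = 0 vanish.
_⋆_ : (ℕ → ℤ) → (ℕ → ℤ) → ℕ → ℤ
(f ⋆ h) n = Σ< (suc n) λ a → Σ< (suc n) λ b → when (a * b ≟ n) (f a *ᶻ h b)

⋆-widen : ∀ f h n M → 1 ≤ n → n < M →
          (f ⋆ h) n ≡ Σ< M λ a → Σ< M λ b → when (a * b ≟ n) (f a *ᶻ h b)
⋆-widen f h n M 1≤n n<M = sym (trans (Σ<-cong M (λ a _ → inner a)) (Σ<-zero-tail (suc n) M _ n<M outer))
  where
  inner : ∀ a → Σ< M (λ b → when (a * b ≟ n) (f a *ᶻ h b)) ≡ Σ< (suc n) (λ b → when (a * b ≟ n) (f a *ᶻ h b))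
  inner a = Σ<-zero-tail (suc n) M _ n<M λ b n<b _ →
    when-no (λ ab≡n → ℕP.<⇒≱ n<b (proj₂ (*≡⇒boundsʳ a b n ab≡n 1≤n))) (a * b ≟ n)
  outer : ∀ a → suc n ≤ a → a < M → Σ< (suc n) (λ b → when (a * b ≟ n) (f a *ᶻ h b)) ≡ 0ℤ
  outer a n<a _ = Σ<-zero (suc n) λ b _ →
    when-no (λ ab≡n → ℕP.<⇒≱ n<a (proj₂ (*≡⇒boundsˡ a b n ab≡n 1≤n))) (a * b ≟ n)

Σ<-cofactor : ∀ i n (G : ℕ → ℤ) → 1 ≤ n →
              Σ< (suc n) (λ b → when (suc i * b ≟ n) (G b)) ≡ when (suc i ∣? n) (G (n / suc i))
Σ<-cofactor i n G 1≤n with suc i ∣? n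
... | yes (divides q n≡qa) =
  trans (Σ<-cong (suc n) (λ b _ → when-⇔ {x = G b} cofactor≡q cofactor≡n (suc i * b ≟ n) (b ≟ q)))
  (trans (Σ<-δ (suc n) q G)
  (trans (when-yes (s≤s (proj₂ (*≡⇒boundsʳ (suc i) q n (cofactor≡n refl) 1≤n))) (q <? suc n))
         (cong G (sym n/a≡q))))
  where
  cofactor≡q : ∀ {b} → suc i * b ≡ n → b ≡ q
  cofactor≡q {b} ab≡n = ℕP.*-cancelˡ-≡ b q (suc i) (trans ab≡n (trans n≡qa (ℕP.*-comm q (suc i))))
  cofactor≡n : ∀ {b} → b ≡ q → suc i * b ≡ n
  cofactor≡n refl = trans (ℕP.*-comm (suc i) q) (sym n≡qa)
  n/a≡q : n / suc i ≡ q
  n/a≡q = trans (cong (_/ suc i) n≡qa) (DM.m*n/n≡m q (suc i))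
... | no a∤n = Σ<-zero (suc n) λ b _ →
  when-no (λ ab≡n → a∤n (divides b (trans (sym ab≡n) (ℕP.*-comm (suc i) b)))) (suc i * b ≟ n)

sum-map-range1 : ∀ (t : ℕ → ℤ) n → foldr _+ᶻ_ 0ℤ (map t (range1 n)) ≡ Σ< n (t ∘ suc)
sum-map-range1 t zero    = refl
sum-map-range1 t (suc n) = begin
  foldr _+ᶻ_ 0ℤ (map t (range1 n ++ suc n ∷ []))          ≡⟨ cong (foldr _+ᶻ_ 0ℤ) (map-++ t (range1 n) (suc n ∷ [])) ⟩
  foldr _+ᶻ_ 0ℤ (map t (range1 n) ++ t (suc n) ∷ [])      ≡⟨ sum-snoc (map t (range1 n)) (t (suc n)) ⟩
  foldr _+ᶻ_ 0ℤ (map t (range1 n)) +ᶻ t (suc n)           ≡⟨ cong (_+ᶻ t (suc n)) (sum-map-range1 t n) ⟩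
  Σ< n (t ∘ suc) +ᶻ t (suc n)                             ∎
  where
  open ≡-Reasoning
  sum-snoc : ∀ xs y → foldr _+ᶻ_ 0ℤ (xs ++ y ∷ []) ≡ foldr _+ᶻ_ 0ℤ xs +ᶻ y
  sum-snoc []       y = trans (ℤP.+-identityʳ y) (sym (ℤP.+-identityˡ y))
  sum-snoc (x ∷ xs) y = trans (cong (x +ᶻ_) (sum-snoc xs y)) (sym (ℤP.+-assoc x _ y))

dirichlet≡Σ< : ∀ f h n → dirichlet f h n ≡ Σ< n (λ i → when (suc i ∣? n) (f (suc i) *ᶻ h (n / suc i)))
dirichlet≡Σ< f h n = proof
  where
  -- The left side is the summand local to `dirichlet`, which is out of scope here;
  -- it is inferred from its use in `proof`, checked before the clauses of term≡.
  term≡ : ∀ i → _ ≡ when (suc i ∣? n) (f (suc i) *ᶻ h (n / suc i))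
  proof : dirichlet f h n ≡ Σ< n (λ i → when (suc i ∣? n) (f (suc i) *ᶻ h (n / suc i)))
  proof = trans (sum-map-range1 _ n) (Σ<-cong n (λ i _ → term≡ i))
  term≡ i with suc i ∣? n
  ... | yes _ = refl
  ... | no _  = refl

dirichlet≡⋆ : ∀ f h n → 1 ≤ n → dirichlet f h n ≡ (f ⋆ h) n
dirichlet≡⋆ f h n 1≤n = begin
  dirichlet f h n
    ≡⟨ dirichlet≡Σ< f h n ⟩
  Σ< n (λ i → when (suc i ∣? n) (f (suc i) *ᶻ h (n / suc i)))
    ≡⟨ Σ<-cong n (λ i _ → sym (Σ<-cofactor i n (λ b → f (suc i) *ᶻ h b) 1≤n)) ⟩
  Σ< n (λ i → row (suc i))
    ≡⟨ sym (ℤP.+-identityˡ _) ⟩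
  0ℤ +ᶻ Σ< n (λ i → row (suc i))
    ≡⟨ cong (_+ᶻ Σ< n (λ i → row (suc i))) (sym row0≡0) ⟩
  row 0 +ᶻ Σ< n (λ i → row (suc i))
    ≡⟨ sym (Σ<-suc n row) ⟩
  (f ⋆ h) n ∎
  where
  open ≡-Reasoning
  row : ℕ → ℤ
  row a = Σ< (suc n) λ b → when (a * b ≟ n) (f a *ᶻ h b)
  row0≡0 : row 0 ≡ 0ℤ
  row0≡0 = Σ<-zero (suc n) (λ b _ → when-no (λ 0≡n → ℕP.<-irrefl 0≡n 1≤n) (0 * b ≟ n))

⋆-comm : ∀ f h n → (f ⋆ h) n ≡ (h ⋆ f) n
⋆-comm f h n = trans (Σ<-comm (suc n) (suc n) _) (Σ<-cong (suc n) λ b _ → Σ<-cong (suc n) λ a _ →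
  trans (when-cong (a * b ≟ n) (λ _ → ℤP.*-comm (f a) (h b)))
        (when-⇔ (trans (ℕP.*-comm b a)) (trans (ℕP.*-comm a b)) (a * b ≟ n) (b * a ≟ n)))

⋆-cong : ∀ {f f′ h h′} n → 1 ≤ n →
         (∀ a → 1 ≤ a → a ≤ n → f a ≡ f′ a) → (∀ b → 1 ≤ b → b ≤ n → h b ≡ h′ b) →
         (f ⋆ h) n ≡ (f′ ⋆ h′) n
⋆-cong n 1≤n f≡f′ h≡h′ = Σ<-cong (suc n) λ a _ → Σ<-cong (suc n) λ b _ → when-cong (a * b ≟ n) λ ab≡n →
  cong₂ _*ᶻ_ (uncurry (f≡f′ a) (*≡⇒boundsˡ a b n ab≡n 1≤n)) (uncurry (h≡h′ b) (*≡⇒boundsʳ a b n ab≡n 1≤n))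

⋆-congˡ : ∀ {f f′} h n → 1 ≤ n → (∀ a → 1 ≤ a → a ≤ n → f a ≡ f′ a) → (f ⋆ h) n ≡ (f′ ⋆ h) n
⋆-congˡ h n 1≤n f≡f′ = ⋆-cong {h = h} {h′ = h} n 1≤n f≡f′ (λ _ _ _ → refl)

⋆-congʳ : ∀ f {h h′} n → 1 ≤ n → (∀ b → 1 ≤ b → b ≤ n → h b ≡ h′ b) → (f ⋆ h) n ≡ (f ⋆ h′) n
⋆-congʳ f n 1≤n h≡h′ = ⋆-cong {f = f} {f′ = f} n 1≤n (λ _ _ _ → refl) h≡h′

⋆-distribˡ-+ : ∀ f h₁ h₂ n → (f ⋆ (λ b → h₁ b +ᶻ h₂ b)) n ≡ (f ⋆ h₁) n +ᶻ (f ⋆ h₂) n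
⋆-distribˡ-+ f h₁ h₂ n =
  trans (Σ<-cong (suc n) λ a _ →
          trans (Σ<-cong (suc n) λ b _ →
                  trans (cong (when (a * b ≟ n)) (ℤP.*-distribˡ-+ (f a) (h₁ b) (h₂ b))) (when-+ (a * b ≟ n) _ _))
                (Σ<-distrib-+ (suc n) _ _))
        (Σ<-distrib-+ (suc n) _ _)

δ : ℕ → ℤ → ℕ → ℤ
δ k c b = when (b ≟ k) c

ε : ℕ → ℤ
ε = δ 1 1ℤ

⋆-δ : ∀ f j c n → 1 ≤ n → (f ⋆ δ (suc j) c) n ≡ when (suc j ∣? n) (f (n / suc j) *ᶻ c)
⋆-δ f j c n 1≤n = begin
  (f ⋆ δ (suc j) c) n
    ≡⟨ Σ<-cong (suc n) (λ a _ → Σ<-cong (suc n) λ b _ →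
         trans (cong (when (a * b ≟ n)) (when-*ˡ (b ≟ suc j) c (f a))) (when-comm (a * b ≟ n) (b ≟ suc j) _)) ⟩
  Σ< (suc n) (λ a → Σ< (suc n) λ b → when (b ≟ suc j) (when (a * b ≟ n) (f a *ᶻ c)))
    ≡⟨ Σ<-comm (suc n) (suc n) _ ⟩
  Σ< (suc n) (λ b → Σ< (suc n) λ a → when (b ≟ suc j) (when (a * b ≟ n) (f a *ᶻ c)))
    ≡⟨ Σ<-cong (suc n) (λ b _ → sym (when-Σ< (b ≟ suc j) (suc n) _)) ⟩
  Σ< (suc n) (λ b → when (b ≟ suc j) (column b))
    ≡⟨ Σ<-δ (suc n) (suc j) column ⟩
  when (suc j <? suc n) (column (suc j))
    ≡⟨ cong (when (suc j <? suc n)) (trans column-comm (Σ<-cofactor j n (λ a → f a *ᶻ c) 1≤n)) ⟩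
  when (suc j <? suc n) (when (suc j ∣? n) (f (n / suc j) *ᶻ c))
    ≡⟨ when-redundant (s≤s ∘ ∣⇒≤ {{ℕ.>-nonZero 1≤n}}) (suc j <? suc n) (suc j ∣? n) _ ⟩
  when (suc j ∣? n) (f (n / suc j) *ᶻ c) ∎
  where
  open ≡-Reasoning
  column : ℕ → ℤ
  column b = Σ< (suc n) λ a → when (a * b ≟ n) (f a *ᶻ c)
  column-comm : column (suc j) ≡ Σ< (suc n) λ a → when (suc j * a ≟ n) (f a *ᶻ c)
  column-comm = Σ<-cong (suc n) λ a _ →
    when-⇔ (trans (ℕP.*-comm (suc j) a)) (trans (ℕP.*-comm a (suc j))) (a * suc j ≟ n) (suc j * a ≟ n)

⋆-identityʳ : ∀ f n → 1 ≤ n → (f ⋆ ε) n ≡ f n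
⋆-identityʳ f n 1≤n = begin
  (f ⋆ ε) n                       ≡⟨ ⋆-δ f 0 1ℤ n 1≤n ⟩
  when (1 ∣? n) (f (n / 1) *ᶻ 1ℤ) ≡⟨ when-yes (1∣ n) (1 ∣? n) ⟩
  f (n / 1) *ᶻ 1ℤ                 ≡⟨ ℤP.*-identityʳ _ ⟩
  f (n / 1)                       ≡⟨ cong f (DM.n/1≡n n) ⟩
  f n                             ∎
  where open ≡-Reasoning

⋆-identityˡ : ∀ f n → 1 ≤ n → (ε ⋆ f) n ≡ f n
⋆-identityˡ f n 1≤n = trans (⋆-comm ε f n) (⋆-identityʳ f n 1≤n)

when-≟-sym : ∀ m k x → when (m ≟ k) x ≡ when (k ≟ m) x
when-≟-sym m k x = when-⇔ sym sym (m ≟ k) (k ≟ m)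

Σ<-collapse : ∀ N k {P : ℕ → Set} (d : ∀ i → Dec (P i)) x → (P k → k < N) →
              Σ< N (λ i → when (i ≟ k) (when (d i) x)) ≡ when (d k) x
Σ<-collapse N k d x P⇒k<N = trans (Σ<-δ N k (λ i → when (d i) x)) (when-redundant P⇒k<N (k <? N) (d k) x)

Σ<³ : ℕ → (ℕ → ℕ → ℕ → ℤ) → ℤ
Σ<³ N F = Σ< N λ c → Σ< N λ d → Σ< N λ b → F c d b

module _ (f g h : ℕ → ℤ) (n : ℕ) (1≤n : 1 ≤ n) where
  private
    N = suc n

  ⋆-assoc-expandˡ : ((f ⋆ g) ⋆ h) n ≡ Σ<³ N λ c d b → when (c * (d * b) ≟ n) (f c *ᶻ (g d *ᶻ h b))
  ⋆-assoc-expandˡ = begin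
    ((f ⋆ g) ⋆ h) n
      ≡⟨ Σ<-cong N (λ a _ → Σ<-cong N λ b _ → expand a b) ⟩
    Σ< N (λ a → Σ< N λ b → Σ< N λ c → Σ< N λ d → term a b c d)
      ≡⟨ Σ<-cong N (λ a _ → trans (Σ<-comm N N _) (Σ<-cong N λ c _ → Σ<-comm N N _)) ⟩
    Σ< N (λ a → Σ< N λ c → Σ< N λ d → Σ< N λ b → term a b c d)
      ≡⟨ Σ<-comm N N _ ⟩
    Σ< N (λ c → Σ< N λ a → Σ< N λ d → Σ< N λ b → term a b c d)
      ≡⟨ Σ<-cong N (λ c _ → trans (Σ<-comm N N _) (Σ<-cong N λ d _ → Σ<-comm N N _)) ⟩
    Σ<³ N (λ c d b → Σ< N λ a → term a b c d)
      ≡⟨ Σ<-cong N (λ c _ → Σ<-cong N λ d _ → Σ<-cong N λ b _ → collapse c d b) ⟩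
    Σ<³ N (λ c d b → when (c * (d * b) ≟ n) (f c *ᶻ (g d *ᶻ h b))) ∎
    where
    open ≡-Reasoning
    term : ℕ → ℕ → ℕ → ℕ → ℤ
    term a b c d = when (a * b ≟ n) (when (c * d ≟ a) (f c *ᶻ g d *ᶻ h b))
    expand : ∀ a b → when (a * b ≟ n) ((f ⋆ g) a *ᶻ h b) ≡ Σ< N λ c → Σ< N λ d → term a b c d
    expand a b = trans
      (when-cong (a * b ≟ n) λ ab≡n →
        trans (cong (_*ᶻ h b) (⋆-widen f g a N (proj₁ (*≡⇒boundsˡ a b n ab≡n 1≤n)) (s≤s (proj₂ (*≡⇒boundsˡ a b n ab≡n 1≤n)))))
              (trans (*-distribʳ-Σ< N (h b) _) (Σ<-cong N λ c _ → trans (*-distribʳ-Σ< N (h b) _)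
                (Σ<-cong N λ d _ → when-*ʳ (c * d ≟ a) _ (h b)))))
      (trans (when-Σ< (a * b ≟ n) N _) (Σ<-cong N λ c _ → when-Σ< (a * b ≟ n) N _))
    collapse : ∀ c d b → Σ< N (λ a → term a b c d) ≡ when (c * (d * b) ≟ n) (f c *ᶻ (g d *ᶻ h b))
    collapse c d b = begin
      Σ< N (λ a → term a b c d)
        ≡⟨ Σ<-cong N (λ a _ → trans (when-comm (a * b ≟ n) (c * d ≟ a) _) (when-≟-sym (c * d) a _)) ⟩
      Σ< N (λ a → when (a ≟ c * d) (when (a * b ≟ n) (f c *ᶻ g d *ᶻ h b)))
        ≡⟨ Σ<-collapse N (c * d) (λ a → a * b ≟ n) _ (λ cdb≡n → s≤s (proj₂ (*≡⇒boundsˡ (c * d) b n cdb≡n 1≤n))) ⟩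
      when (c * d * b ≟ n) (f c *ᶻ g d *ᶻ h b)
        ≡⟨ when-⇔ (trans (sym (ℕP.*-assoc c d b))) (trans (ℕP.*-assoc c d b)) (c * d * b ≟ n) (c * (d * b) ≟ n) ⟩
      when (c * (d * b) ≟ n) (f c *ᶻ g d *ᶻ h b)
        ≡⟨ cong (when (c * (d * b) ≟ n)) (ℤP.*-assoc (f c) (g d) (h b)) ⟩
      when (c * (d * b) ≟ n) (f c *ᶻ (g d *ᶻ h b)) ∎

  ⋆-assoc-expandʳ : (f ⋆ (g ⋆ h)) n ≡ Σ<³ N λ c d b → when (c * (d * b) ≟ n) (f c *ᶻ (g d *ᶻ h b))
  ⋆-assoc-expandʳ = Σ<-cong N λ c _ → begin
    Σ< N (λ e → when (c * e ≟ n) (f c *ᶻ (g ⋆ h) e))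
      ≡⟨ Σ<-cong N (λ e _ → expand c e) ⟩
    Σ< N (λ e → Σ< N λ d → Σ< N λ b → term c e d b)
      ≡⟨ trans (Σ<-comm N N _) (Σ<-cong N λ d _ → Σ<-comm N N _) ⟩
    Σ< N (λ d → Σ< N λ b → Σ< N λ e → term c e d b)
      ≡⟨ Σ<-cong N (λ d _ → Σ<-cong N λ b _ → collapse c d b) ⟩
    Σ< N (λ d → Σ< N λ b → when (c * (d * b) ≟ n) (f c *ᶻ (g d *ᶻ h b))) ∎
    where
    open ≡-Reasoning
    term : ℕ → ℕ → ℕ → ℕ → ℤ
    term c e d b = when (c * e ≟ n) (when (d * b ≟ e) (f c *ᶻ (g d *ᶻ h b)))
    expand : ∀ c e → when (c * e ≟ n) (f c *ᶻ (g ⋆ h) e) ≡ Σ< N λ d → Σ< N λ b → term c e d b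
    expand c e = trans
      (when-cong (c * e ≟ n) λ ce≡n →
        trans (cong (f c *ᶻ_) (⋆-widen g h e N (proj₁ (*≡⇒boundsʳ c e n ce≡n 1≤n)) (s≤s (proj₂ (*≡⇒boundsʳ c e n ce≡n 1≤n)))))
              (trans (*-distribˡ-Σ< N (f c) _) (Σ<-cong N λ d _ → trans (*-distribˡ-Σ< N (f c) _)
                (Σ<-cong N λ b _ → when-*ˡ (d * b ≟ e) _ (f c)))))
      (trans (when-Σ< (c * e ≟ n) N _) (Σ<-cong N λ d _ → when-Σ< (c * e ≟ n) N _))
    collapse : ∀ c d b → Σ< N (λ e → term c e d b) ≡ when (c * (d * b) ≟ n) (f c *ᶻ (g d *ᶻ h b))
    collapse c d b =
      trans (Σ<-cong N λ e _ → trans (when-comm (c * e ≟ n) (d * b ≟ e) _) (when-≟-sym (d * b) e _))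
            (Σ<-collapse N (d * b) (λ e → c * e ≟ n) _ (λ cdb≡n → s≤s (proj₂ (*≡⇒boundsʳ c (d * b) n cdb≡n 1≤n))))

  ⋆-assoc : ((f ⋆ g) ⋆ h) n ≡ (f ⋆ (g ⋆ h)) n
  ⋆-assoc = trans ⋆-assoc-expandˡ (sym ⋆-assoc-expandʳ)

-- Removing one prime from the Möbius function

n<m^n : ∀ m → 2 ≤ m → ∀ n → n < m ^ n
n<m^n m 2≤m zero    = s≤s z≤n
n<m^n m 2≤m (suc n) = begin-strict
  suc n           ≡⟨ ℕP.+-comm 1 n ⟩
  n ℕ.+ 1         <⟨ ℕP.+-mono-<-≤ (n<m^n m 2≤m n) (ℕP.m^n>0 m {{ℕ.>-nonZero (ℕP.<-trans (s≤s z≤n) 2≤m)}} n) ⟩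
  m ^ n ℕ.+ m ^ n ≡⟨ cong (m ^ n ℕ.+_) (sym (ℕP.+-identityʳ (m ^ n))) ⟩
  2 * m ^ n       ≤⟨ ℕP.*-monoˡ-≤ (m ^ n) 2≤m ⟩
  m * m ^ n       ∎
  where open ℕP.≤-Reasoning

prime⇒2≤ : ∀ {p} → Prime p → 2 ≤ p
prime⇒2≤ {p} pr = ℕ.nonTrivial⇒n>1 p {{prime⇒nonTrivial pr}}

quotient-bounds : ∀ {n d} .{{_ : NonZero d}} → 1 ≤ n → d ∣ n → 2 ≤ d → 1 ≤ n / d × n / d < n
quotient-bounds {n} {d} 1≤n d∣n 2≤d =
  ℕP.≤-trans (ℕP.≤-reflexive (sym (DM.n/n≡1 d))) (DM./-monoˡ-≤ d (∣⇒≤ {{ℕ.>-nonZero 1≤n}} d∣n)) ,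
  DM.m/n<m n d {{ℕ.>-nonZero 1≤n}} 2≤d

1≤n∧n≡q*m⇒1≤q : ∀ {n q} m → 1 ≤ n → n ≡ q * m → 1 ≤ q
1≤n∧n≡q*m⇒1≤q {q = zero}  m 1≤n n≡0 = ⊥-elim (ℕP.<-irrefl (sym n≡0) 1≤n)
1≤n∧n≡q*m⇒1≤q {q = suc _} m _   _   = s≤s z≤n

x+x*-1≡0 : ∀ x → x +ᶻ x *ᶻ -1ℤ ≡ 0ℤ
x+x*-1≡0 = solve-∀

𝟙 : ℕ → ℤ
𝟙 _ = 1ℤ

ε≡0 : ∀ {n} → 2 ≤ n → ε n ≡ 0ℤ
ε≡0 {n} 2≤n = when-no (λ n≡1 → ℕP.<-irrefl (sym n≡1) 2≤n) (n ≟ 1)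

-- for p ≥ 2 the indicator of the powers of p
powersOf : ℕ → ℕ → ℤ
powersOf p n = Σ< (suc n) λ k → when (p ^ k ≟ n) 1ℤ

coprimeTo : ℕ → ℕ → ℤ
coprimeTo p b = when (¬? (p ∣? b)) 1ℤ

coprimeTo-1 : ∀ p → 2 ≤ p → coprimeTo p 1 ≡ 1ℤ
coprimeTo-1 p 2≤p = when-yes (λ p∣1 → ℕP.<⇒≱ 2≤p (∣⇒≤ p∣1)) (¬? (p ∣? 1))

-- the Euler factor 1 − p^{-s}
ε-δ : ℕ → ℕ → ℤ
ε-δ p b = ε b +ᶻ δ p -1ℤ b

module PrimeFactor (j : ℕ) (pr : Prime (suc j)) where
  private
    P = suc j
    2≤P = prime⇒2≤ pr

  ⋆ε-δ : ∀ f n → 1 ≤ n → (f ⋆ ε-δ P) n ≡ f n +ᶻ when (P ∣? n) (f (n / P) *ᶻ -1ℤ)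
  ⋆ε-δ f n 1≤n = trans (⋆-distribˡ-+ f ε (δ P -1ℤ) n) (cong₂ _+ᶻ_ (⋆-identityʳ f n 1≤n) (⋆-δ f j -1ℤ n 1≤n))

  q<q*P : ∀ q → 1 ≤ q → q < q * P
  q<q*P q 1≤q = ℕP.m<m*n q P {{ℕ.>-nonZero 1≤q}} 2≤P

  2≤q*P : ∀ q → 1 ≤ q → 2 ≤ q * P
  2≤q*P q 1≤q = ℕP.≤-trans 2≤P (ℕP.m≤n*m P q {{ℕ.>-nonZero 1≤q}})

  P∣⇒2≤ : ∀ {n} → 1 ≤ n → P ∣ n → 2 ≤ n
  P∣⇒2≤ 1≤n P∣n = ℕP.≤-trans 2≤P (∣⇒≤ {{ℕ.>-nonZero 1≤n}} P∣n)

  powersOf-*P : ∀ q → 1 ≤ q → powersOf P (q * P) ≡ powersOf P q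
  powersOf-*P q 1≤q = begin
    powersOf P (q * P)
      ≡⟨ Σ<-suc (q * P) _ ⟩
    when (1 ≟ q * P) 1ℤ +ᶻ Σ< (q * P) (λ k → when (P * P ^ k ≟ q * P) 1ℤ)
      ≡⟨ cong₂ _+ᶻ_ (when-no (λ 1≡qP → ℕP.<-irrefl 1≡qP (2≤q*P q 1≤q)) (1 ≟ q * P)) (Σ<-cong (q * P) λ k _ → cancel k) ⟩
    0ℤ +ᶻ Σ< (q * P) (λ k → when (P ^ k ≟ q) 1ℤ)
      ≡⟨ ℤP.+-identityˡ _ ⟩
    Σ< (q * P) (λ k → when (P ^ k ≟ q) 1ℤ)
      ≡⟨ Σ<-zero-tail (suc q) (q * P) _ (q<q*P q 1≤q) (λ k q<k _ →
           when-no (λ P^k≡q → ℕP.<-irrefl (sym P^k≡q) (ℕP.<-trans q<k (n<m^n P 2≤P k))) (P ^ k ≟ q)) ⟩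
    powersOf P q ∎
    where
    open ≡-Reasoning
    cancel : ∀ k → when (P * P ^ k ≟ q * P) 1ℤ ≡ when (P ^ k ≟ q) 1ℤ
    cancel k = when-⇔ (λ e → ℕP.*-cancelˡ-≡ (P ^ k) q P (trans e (ℕP.*-comm q P)))
                      (λ e → trans (cong (P *_) e) (ℕP.*-comm P q)) (P * P ^ k ≟ q * P) (P ^ k ≟ q)

  powersOf⋆ε-δ≡ε : ∀ n → 1 ≤ n → (powersOf P ⋆ ε-δ P) n ≡ ε n
  powersOf⋆ε-δ≡ε n 1≤n = trans (⋆ε-δ (powersOf P) n 1≤n) (by-cases (P ∣? n))
    where
    by-cases : (d : Dec (P ∣ n)) → powersOf P n +ᶻ when d (powersOf P (n / P) *ᶻ -1ℤ) ≡ ε n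
    by-cases (yes P∣n@(divides q n≡qP)) = begin
      powersOf P n +ᶻ powersOf P (n / P) *ᶻ -1ℤ
        ≡⟨ cong₂ (λ a b → powersOf P a +ᶻ powersOf P b *ᶻ -1ℤ) n≡qP (trans (cong (_/ P) n≡qP) (DM.m*n/n≡m q P)) ⟩
      powersOf P (q * P) +ᶻ powersOf P q *ᶻ -1ℤ
        ≡⟨ cong (_+ᶻ powersOf P q *ᶻ -1ℤ) (powersOf-*P q (1≤n∧n≡q*m⇒1≤q P 1≤n n≡qP)) ⟩
      powersOf P q +ᶻ powersOf P q *ᶻ -1ℤ
        ≡⟨ x+x*-1≡0 (powersOf P q) ⟩
      0ℤ
        ≡⟨ sym (ε≡0 (P∣⇒2≤ 1≤n P∣n)) ⟩
      ε n ∎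
      where open ≡-Reasoning
    by-cases (no P∤n) = begin
      powersOf P n +ᶻ 0ℤ
        ≡⟨ trans (ℤP.+-identityʳ _) (Σ<-suc n _) ⟩
      when (1 ≟ n) 1ℤ +ᶻ Σ< n (λ k → when (P * P ^ k ≟ n) 1ℤ)
        ≡⟨ cong (when (1 ≟ n) 1ℤ +ᶻ_) (Σ<-zero n λ k _ →
             when-no (λ e → P∤n (divides (P ^ k) (trans (sym e) (ℕP.*-comm P (P ^ k))))) (P * P ^ k ≟ n)) ⟩
      when (1 ≟ n) 1ℤ +ᶻ 0ℤ
        ≡⟨ trans (ℤP.+-identityʳ _) (when-≟-sym 1 n 1ℤ) ⟩
      ε n ∎
      where open ≡-Reasoning

  𝟙⋆ε-δ≡coprimeTo : ∀ n → 1 ≤ n → (𝟙 ⋆ ε-δ P) n ≡ coprimeTo P n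
  𝟙⋆ε-δ≡coprimeTo n 1≤n = trans (⋆ε-δ 𝟙 n 1≤n) (by-cases (P ∣? n))
    where
    by-cases : (d : Dec (P ∣ n)) → 1ℤ +ᶻ when d (1ℤ *ᶻ -1ℤ) ≡ when (¬? d) 1ℤ
    by-cases (yes _) = refl
    by-cases (no _)  = refl

  module _ (μ : ℕ → ℤ) (μ⋆𝟙≡ε : ∀ n → 1 ≤ n → (μ ⋆ 𝟙) n ≡ ε n) where

    -- μ with its Euler factor at P removed: it agrees with μ off the multiples of P and vanishes on them.
    μ′ : ℕ → ℤ
    μ′ = μ ⋆ powersOf P

    μ′⋆𝟙≡powersOf : ∀ n → 1 ≤ n → (μ′ ⋆ 𝟙) n ≡ powersOf P n
    μ′⋆𝟙≡powersOf n 1≤n = begin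
      (μ ⋆ powersOf P ⋆ 𝟙) n ≡⟨ ⋆-assoc μ (powersOf P) 𝟙 n 1≤n ⟩
      (μ ⋆ (powersOf P ⋆ 𝟙)) n ≡⟨ ⋆-congʳ μ n 1≤n (λ c _ _ → ⋆-comm (powersOf P) 𝟙 c) ⟩
      (μ ⋆ (𝟙 ⋆ powersOf P)) n ≡⟨ sym (⋆-assoc μ 𝟙 (powersOf P) n 1≤n) ⟩
      (μ ⋆ 𝟙 ⋆ powersOf P) n   ≡⟨ ⋆-congˡ (powersOf P) n 1≤n (λ c 1≤c _ → μ⋆𝟙≡ε c 1≤c) ⟩
      (ε ⋆ powersOf P) n       ≡⟨ ⋆-identityˡ (powersOf P) n 1≤n ⟩
      powersOf P n             ∎
      where open ≡-Reasoning

    μ′⋆coprimeTo≡ε : ∀ n → 1 ≤ n → (μ′ ⋆ coprimeTo P) n ≡ ε n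
    μ′⋆coprimeTo≡ε n 1≤n = begin
      (μ′ ⋆ coprimeTo P) n     ≡⟨ ⋆-congʳ μ′ n 1≤n (λ b 1≤b _ → sym (𝟙⋆ε-δ≡coprimeTo b 1≤b)) ⟩
      (μ′ ⋆ (𝟙 ⋆ ε-δ P)) n     ≡⟨ sym (⋆-assoc μ′ 𝟙 (ε-δ P) n 1≤n) ⟩
      (μ′ ⋆ 𝟙 ⋆ ε-δ P) n       ≡⟨ ⋆-congˡ (ε-δ P) n 1≤n (λ b 1≤b _ → μ′⋆𝟙≡powersOf b 1≤b) ⟩
      (powersOf P ⋆ ε-δ P) n   ≡⟨ powersOf⋆ε-δ≡ε n 1≤n ⟩
      ε n                      ∎
      where open ≡-Reasoning

    μ≡μ′⋆ε-δ : ∀ n → 1 ≤ n → μ n ≡ μ′ n +ᶻ when (P ∣? n) (μ′ (n / P) *ᶻ -1ℤ)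
    μ≡μ′⋆ε-δ n 1≤n = begin
      μ n                           ≡⟨ sym (⋆-identityʳ μ n 1≤n) ⟩
      (μ ⋆ ε) n                     ≡⟨ ⋆-congʳ μ n 1≤n (λ b 1≤b _ → sym (powersOf⋆ε-δ≡ε b 1≤b)) ⟩
      (μ ⋆ (powersOf P ⋆ ε-δ P)) n  ≡⟨ sym (⋆-assoc μ (powersOf P) (ε-δ P) n 1≤n) ⟩
      (μ′ ⋆ ε-δ P) n                ≡⟨ ⋆ε-δ μ′ n 1≤n ⟩
      μ′ n +ᶻ when (P ∣? n) (μ′ (n / P) *ᶻ -1ℤ) ∎
      where open ≡-Reasoning

    P∣⇒μ′≡0 : ∀ n → 1 ≤ n → P ∣ n → μ′ n ≡ 0ℤ
    P∣⇒μ′≡0 = <-rec (λ n → 1 ≤ n → P ∣ n → μ′ n ≡ 0ℤ) step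
      where
      step : ∀ n → (∀ {m} → m < n → 1 ≤ m → P ∣ m → μ′ m ≡ 0ℤ) → 1 ≤ n → P ∣ n → μ′ n ≡ 0ℤ
      step n IH 1≤n P∣n = begin
        μ′ n                                             ≡⟨ sym (trans (Σ<-δ N n μ′) (when-yes ℕP.≤-refl (n <? N))) ⟩
        Σ< N (λ a → when (a ≟ n) (μ′ a))                 ≡⟨ Σ<-cong N (λ a _ → sym (only-b≡1 a)) ⟩
        (μ′ ⋆ coprimeTo P) n                             ≡⟨ μ′⋆coprimeTo≡ε n 1≤n ⟩
        ε n                                              ≡⟨ ε≡0 (P∣⇒2≤ 1≤n P∣n) ⟩
        0ℤ                                               ∎
        where
        open ≡-Reasoning
        N = suc n
        -- a summand with b ≠ 1 vanishes: either P ∣ b, or P ∣ a with a < n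
        term : ∀ a b → when (a * b ≟ n) (μ′ a *ᶻ coprimeTo P b) ≡ when (b ≟ 1) (when (a ≟ n) (μ′ a))
        term a b with a * b ≟ n | b ≟ 1
        ... | yes a1≡n | yes refl =
          trans (cong (μ′ a *ᶻ_) (coprimeTo-1 P 2≤P))
                (trans (ℤP.*-identityʳ (μ′ a)) (sym (when-yes (trans (sym (ℕP.*-identityʳ a)) a1≡n) (a ≟ n))))
        ... | no a1≢n | yes refl = sym (when-no (λ a≡n → a1≢n (trans (ℕP.*-identityʳ a) a≡n)) (a ≟ n))
        ... | no _    | no _     = refl
        ... | yes ab≡n | no b≢1 with P ∣? b
        ...   | yes _   = ℤP.*-zeroʳ (μ′ a)
        ...   | no P∤b = cong (_*ᶻ 1ℤ) (IH a<n 1≤a P∣a)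
          where
          1≤a = proj₁ (*≡⇒boundsˡ a b n ab≡n 1≤n)
          a<n : a < n
          a<n = ℕP.<-≤-trans (ℕP.m<m*n a b {{ℕ.>-nonZero 1≤a}}
                               (ℕP.≤∧≢⇒< (proj₁ (*≡⇒boundsʳ a b n ab≡n 1≤n)) (b≢1 ∘ sym)))
                             (ℕP.≤-reflexive ab≡n)
          P∣a : P ∣ a
          P∣a = [ id , (λ P∣b → ⊥-elim (P∤b P∣b)) ]′ (euclidsLemma a b pr (subst (P ∣_) (sym ab≡n) P∣n))
        only-b≡1 : ∀ a → Σ< N (λ b → when (a * b ≟ n) (μ′ a *ᶻ coprimeTo P b)) ≡ when (a ≟ n) (μ′ a)
        only-b≡1 a = trans (Σ<-cong N λ b _ → term a b) (trans (Σ<-δ N 1 _) (when-yes (s≤s 1≤n) (1 <? N)))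

    P∤⇒μ≡μ′ : ∀ n → 1 ≤ n → ¬ P ∣ n → μ n ≡ μ′ n
    P∤⇒μ≡μ′ n 1≤n P∤n = begin
      μ n                                       ≡⟨ μ≡μ′⋆ε-δ n 1≤n ⟩
      μ′ n +ᶻ when (P ∣? n) (μ′ (n / P) *ᶻ -1ℤ) ≡⟨ cong (μ′ n +ᶻ_) (when-no P∤n (P ∣? n)) ⟩
      μ′ n +ᶻ 0ℤ                                ≡⟨ ℤP.+-identityʳ _ ⟩
      μ′ n                                      ∎
      where open ≡-Reasoning

    P∣⇒μ≡-μ′[/P] : ∀ n → 1 ≤ n → P ∣ n → μ n ≡ -ᶻ μ′ (n / P)
    P∣⇒μ≡-μ′[/P] n 1≤n P∣n = begin
      μ n                                       ≡⟨ μ≡μ′⋆ε-δ n 1≤n ⟩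
      μ′ n +ᶻ when (P ∣? n) (μ′ (n / P) *ᶻ -1ℤ) ≡⟨ cong₂ _+ᶻ_ (P∣⇒μ′≡0 n 1≤n P∣n) (when-yes P∣n (P ∣? n)) ⟩
      0ℤ +ᶻ μ′ (n / P) *ᶻ -1ℤ                   ≡⟨ ℤP.+-identityˡ _ ⟩
      μ′ (n / P) *ᶻ -1ℤ                         ≡⟨ trans (ℤP.*-comm _ -1ℤ) (ℤP.-1*i≡-i _) ⟩
      -ᶻ μ′ (n / P)                             ∎
      where open ≡-Reasoning

    P∣⇒μ≡0⊎μ≡-μ[/P] : ∀ n → 1 ≤ n → P ∣ n → μ n ≡ 0ℤ ⊎ μ n ≡ -ᶻ μ (n / P)
    P∣⇒μ≡0⊎μ≡-μ[/P] n 1≤n P∣n with P ∣? (n / P)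
    ... | yes P∣n/P = inj₁ (trans (P∣⇒μ≡-μ′[/P] n 1≤n P∣n) (cong -ᶻ_ (P∣⇒μ′≡0 (n / P) 1≤n/P P∣n/P)))
      where 1≤n/P = proj₁ (quotient-bounds 1≤n P∣n 2≤P)
    ... | no P∤n/P  = inj₂ (trans (P∣⇒μ≡-μ′[/P] n 1≤n P∣n) (cong -ᶻ_ (sym (P∤⇒μ≡μ′ (n / P) 1≤n/P P∤n/P))))
      where 1≤n/P = proj₁ (quotient-bounds 1≤n P∣n 2≤P)

-- Prime valuations and the Liouville function

module _ {Q : ℕ → Set} (Q? : Decidable Q) where

  sum-filter-range1 : ∀ (F : ℕ → ℕ) n →
                      + sum (map F (filter Q? (range1 n))) ≡ Σ< n (λ i → when (Q? (suc i)) (+ F (suc i)))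
  sum-filter-range1 F zero    = refl
  sum-filter-range1 F (suc n) = begin
    + sum (map F (filter Q? (range1 n ++ suc n ∷ [])))
      ≡⟨ cong (λ xs → + sum (map F xs)) (filter-++ Q? (range1 n) (suc n ∷ [])) ⟩
    + sum (map F (filter Q? (range1 n) ++ filter Q? (suc n ∷ [])))
      ≡⟨ cong (+_ ∘ sum) (map-++ F (filter Q? (range1 n)) _) ⟩
    + sum (map F (filter Q? (range1 n)) ++ map F (filter Q? (suc n ∷ [])))
      ≡⟨ trans (cong +_ (sum-++ (map F (filter Q? (range1 n))) _)) (ℤP.pos-+ (sum (map F (filter Q? (range1 n)))) _) ⟩
    + sum (map F (filter Q? (range1 n))) +ᶻ + sum (map F (filter Q? (suc n ∷ [])))
      ≡⟨ cong₂ _+ᶻ_ (sum-filter-range1 F n) last ⟩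
    Σ< (suc n) (λ i → when (Q? (suc i)) (+ F (suc i))) ∎
    where
    open ≡-Reasoning
    last : + sum (map F (filter Q? (suc n ∷ []))) ≡ when (Q? (suc n)) (+ F (suc n))
    last with Q? (suc n)
    ... | yes _ = cong +_ (ℕP.+-identityʳ (F (suc n)))
    ... | no _  = refl

  count-range1 : ∀ n → + length (filter Q? (range1 n)) ≡ Σ< n (λ i → when (Q? (suc i)) 1ℤ)
  count-range1 n = trans (cong +_ (length≡sum-map-1 (filter Q? (range1 n)))) (sum-filter-range1 (λ _ → 1) n)
    where
    length≡sum-map-1 : (xs : List ℕ) → length xs ≡ sum (map (λ _ → 1) xs)
    length≡sum-map-1 []       = refl
    length≡sum-map-1 (x ∷ xs) = cong suc (length≡sum-map-1 xs)

val≡Σ< : ∀ r m → + val r m ≡ Σ< m (λ i → when (r ^ suc i ∣? m) 1ℤ)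
val≡Σ< r m = count-range1 (λ k → r ^ k ∣? m) m

∤⇒val≡0 : ∀ r m → ¬ r ∣ m → + val r m ≡ 0ℤ
∤⇒val≡0 r m r∤m = trans (val≡Σ< r m) (Σ<-zero m λ i _ →
  when-no (λ r^[1+i]∣m → r∤m (∣-trans (m∣m*n (r ^ i)) r^[1+i]∣m)) (r ^ suc i ∣? m))

primes≤ : ℕ → ℕ → ℤ
primes≤ B m = Σ< B λ i → when (prime? (suc i)) (+ val (suc i) m)

Ω≡primes≤ : ∀ m B → 1 ≤ m → m ≤ B → + Ω m ≡ primes≤ B m
Ω≡primes≤ m B 1≤m m≤B = begin
  + Ω m
    ≡⟨ sum-filter-range1 (λ p → prime? p ×-dec p ∣? m) (λ p → val p m) m ⟩
  Σ< m (λ i → when (prime? (suc i) ×-dec suc i ∣? m) (+ val (suc i) m))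
    ≡⟨ Σ<-cong m (λ i _ → trans (when-× (prime? (suc i)) (suc i ∣? m) _)
                                (when-cong (prime? (suc i)) (λ _ → drop-∣ (suc i ∣? m)))) ⟩
  primes≤ m m
    ≡⟨ sym (Σ<-zero-tail m B _ m≤B beyond) ⟩
  primes≤ B m ∎
  where
  open ≡-Reasoning
  drop-∣ : ∀ {i} (d : Dec (suc i ∣ m)) → when d (+ val (suc i) m) ≡ + val (suc i) m
  drop-∣ (yes _)   = refl
  drop-∣ (no ∤m)   = sym (∤⇒val≡0 _ m ∤m)
  beyond : ∀ i → m ≤ i → i < B → when (prime? (suc i)) (+ val (suc i) m) ≡ 0ℤ
  beyond i m≤i _ = trans (when-cong (prime? (suc i)) λ _ →
                            ∤⇒val≡0 (suc i) m (λ ∣m → ℕP.<⇒≱ (s≤s m≤i) (∣⇒≤ {{ℕ.>-nonZero 1≤m}} ∣m)))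
                         (when-zero (prime? (suc i)))

prime∣m^n⇒prime∣m : ∀ {p} m → Prime p → ∀ n → p ∣ m ^ n → p ∣ m
prime∣m^n⇒prime∣m m pr zero    p∣1   = ⊥-elim (ℕP.<-irrefl (sym (∣1⇒≡1 p∣1)) (prime⇒2≤ pr))
prime∣m^n⇒prime∣m m pr (suc n) p∣m^n = [ id , prime∣m^n⇒prime∣m m pr n ]′ (euclidsLemma m (m ^ n) pr p∣m^n)

coprime-^-prime : ∀ {r p} → Prime r → Prime p → r ≢ p → ∀ e → Coprime (r ^ e) p
coprime-^-prime {r} prR prP r≢p e {d} (d∣r^e , d∣p) with prime⇒irreducible prP d∣p
... | inj₁ d≡1   = d≡1
... | inj₂ refl with prime⇒irreducible prR (prime∣m^n⇒prime∣m r prP e d∣r^e)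
...   | inj₁ p≡1 = ⊥-elim (ℕP.<-irrefl (sym p≡1) (prime⇒2≤ prP))
...   | inj₂ p≡r = ⊥-elim (r≢p (sym p≡r))

module _ {r p} (prR : Prime r) (prP : Prime p) .{{_ : NonZero p}} where

  val-*prime : ∀ q → 1 ≤ q → + val r (q * p) ≡ + val r q +ᶻ when (r ≟ p) 1ℤ
  val-*prime q 1≤q with r ≟ p
  ... | yes refl = begin
    + val p (q * p)
      ≡⟨ val≡Σ< p (q * p) ⟩
    Σ< (q * p) (λ k → when (p ^ suc k ∣? q * p) 1ℤ)
      ≡⟨ Σ<-cong (q * p) (λ k _ → when-⇔ (cancel-p k) (unCancel-p k) (p ^ suc k ∣? q * p) (p ^ k ∣? q)) ⟩
    Σ< (q * p) (λ k → when (p ^ k ∣? q) 1ℤ)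
      ≡⟨ Σ<-zero-tail (suc q) (q * p) _ q<q*p (λ k q<k _ → when-no (¬p^k∣q k (ℕP.<-trans q<k (n<m^n p 2≤p k))) (p ^ k ∣? q)) ⟩
    Σ< (suc q) (λ k → when (p ^ k ∣? q) 1ℤ)
      ≡⟨ Σ<-suc q _ ⟩
    when (1 ∣? q) 1ℤ +ᶻ Σ< q (λ k → when (p ^ suc k ∣? q) 1ℤ)
      ≡⟨ cong₂ _+ᶻ_ (when-yes (1∣ q) (1 ∣? q)) (sym (val≡Σ< p q)) ⟩
    1ℤ +ᶻ + val p q
      ≡⟨ ℤP.+-comm 1ℤ (+ val p q) ⟩
    + val p q +ᶻ 1ℤ ∎
    where
    open ≡-Reasoning
    2≤p = prime⇒2≤ prP
    q<q*p = ℕP.m<m*n q p {{ℕ.>-nonZero 1≤q}} 2≤p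
    cancel-p : ∀ k → p ^ suc k ∣ q * p → p ^ k ∣ q
    cancel-p k = *-cancelʳ-∣ p ∘ subst (_∣ q * p) (ℕP.*-comm p (p ^ k))
    unCancel-p : ∀ k → p ^ k ∣ q → p ^ suc k ∣ q * p
    unCancel-p k = subst (_∣ q * p) (ℕP.*-comm (p ^ k) p) ∘ *-monoˡ-∣ p
    ¬p^k∣q : ∀ k → q < p ^ k → ¬ p ^ k ∣ q
    ¬p^k∣q k q<p^k p^k∣q = ℕP.<⇒≱ q<p^k (∣⇒≤ {{ℕ.>-nonZero 1≤q}} p^k∣q)
  ... | no r≢p = begin
    + val r (q * p)
      ≡⟨ val≡Σ< r (q * p) ⟩
    Σ< (q * p) (λ k → when (r ^ suc k ∣? q * p) 1ℤ)
      ≡⟨ Σ<-cong (q * p) (λ k _ → when-⇔ (drop-p k) (∣m⇒∣m*n p) (r ^ suc k ∣? q * p) (r ^ suc k ∣? q)) ⟩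
    Σ< (q * p) (λ k → when (r ^ suc k ∣? q) 1ℤ)
      ≡⟨ Σ<-zero-tail q (q * p) _ (ℕP.m≤m*n q p) (λ k q≤k _ → when-no (¬r^[1+k]∣q k q≤k) (r ^ suc k ∣? q)) ⟩
    Σ< q (λ k → when (r ^ suc k ∣? q) 1ℤ)
      ≡⟨ sym (val≡Σ< r q) ⟩
    + val r q
      ≡⟨ sym (ℤP.+-identityʳ _) ⟩
    + val r q +ᶻ 0ℤ ∎
    where
    open ≡-Reasoning
    drop-p : ∀ k → r ^ suc k ∣ q * p → r ^ suc k ∣ q
    drop-p k = coprime-divisor (coprime-^-prime prR prP r≢p (suc k)) ∘ subst (r ^ suc k ∣_) (ℕP.*-comm q p)
    ¬r^[1+k]∣q : ∀ k → q ≤ k → ¬ r ^ suc k ∣ q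
    ¬r^[1+k]∣q k q≤k r^[1+k]∣q = ℕP.<⇒≱ (ℕP.≤-<-trans q≤k (ℕP.<-trans (ℕP.n<1+n k) (n<m^n r (prime⇒2≤ prR) (suc k))))
                                        (∣⇒≤ {{ℕ.>-nonZero 1≤q}} r^[1+k]∣q)

Ω-*prime : ∀ {p} → Prime p → ∀ q → 1 ≤ q → Ω (q * p) ≡ suc (Ω q)
Ω-*prime {suc j} prP q 1≤q = ℤP.+-injective (begin
  + Ω (q * p)
    ≡⟨ Ω≡primes≤ (q * p) B 1≤B ℕP.≤-refl ⟩
  primes≤ B (q * p)
    ≡⟨ Σ<-cong B (λ i _ → trans (when-cong (prime? (suc i)) λ prR → val-*prime prR prP q 1≤q) (when-+ (prime? (suc i)) _ _)) ⟩
  Σ< B (λ i → when (prime? (suc i)) (+ val (suc i) q) +ᶻ when (prime? (suc i)) (when (suc i ≟ p) 1ℤ))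
    ≡⟨ Σ<-distrib-+ B _ _ ⟩
  primes≤ B q +ᶻ Σ< B (λ i → when (prime? (suc i)) (when (suc i ≟ p) 1ℤ))
    ≡⟨ cong₂ _+ᶻ_ (sym (Ω≡primes≤ q B 1≤q (ℕP.m≤m*n q p))) count-p ⟩
  + Ω q +ᶻ 1ℤ
    ≡⟨ ℤP.+-comm (+ Ω q) 1ℤ ⟩
  + suc (Ω q) ∎)
  where
  open ≡-Reasoning
  p = suc j
  B = q * p
  1≤B = ℕP.≤-trans 1≤q (ℕP.m≤m*n q p)
  count-p : Σ< B (λ i → when (prime? (suc i)) (when (suc i ≟ p) 1ℤ)) ≡ 1ℤ
  count-p = begin
    Σ< B (λ i → when (prime? (suc i)) (when (suc i ≟ p) 1ℤ))
      ≡⟨ Σ<-cong B (λ i _ → trans (when-comm (prime? (suc i)) (suc i ≟ p) 1ℤ)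
                                  (when-⇔ ℕP.suc-injective (cong suc) (suc i ≟ p) (i ≟ j))) ⟩
    Σ< B (λ i → when (i ≟ j) (when (prime? (suc i)) 1ℤ))
      ≡⟨ Σ<-collapse B j (λ i → prime? (suc i)) 1ℤ (λ _ → ℕP.m≤n*m p q {{ℕ.>-nonZero 1≤q}}) ⟩
    when (prime? p) 1ℤ
      ≡⟨ when-yes prP (prime? p) ⟩
    1ℤ ∎

liouville-*prime : ∀ {p} → Prime p → ∀ q → 1 ≤ q → liouville (q * p) ≡ -ᶻ liouville q
liouville-*prime prP q 1≤q = trans (cong (-1ℤ ℤ.^_) (Ω-*prime prP q 1≤q)) (ℤP.-1*i≡-i (liouville q))

liouville-/prime : ∀ {p} → Prime p → .{{_ : NonZero p}} → ∀ n → 1 ≤ n → p ∣ n → liouville n ≡ -ᶻ liouville (n / p)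
liouville-/prime {p} prP n 1≤n (divides q n≡q*p) = begin
  liouville n           ≡⟨ cong liouville n≡q*p ⟩
  liouville (q * p)     ≡⟨ liouville-*prime prP q (1≤n∧n≡q*m⇒1≤q p 1≤n n≡q*p) ⟩
  -ᶻ liouville q        ≡⟨ cong (-ᶻ_ ∘ liouville) (sym (trans (cong (_/ p) n≡q*p) (DM.m*n/n≡m q p))) ⟩
  -ᶻ liouville (n / p)  ∎
  where open ≡-Reasoning

-- The sign of the inverse of ω + 1

PrimeDivisor : ℕ → Set
PrimeDivisor n = Σ ℕ λ j → Prime (suc j) × suc j ∣ n

∃prime∣ : ∀ n → 2 ≤ n → PrimeDivisor n
∃prime∣ = <-rec (λ n → 2 ≤ n → PrimeDivisor n) step
  where
  step : ∀ n → (∀ {m} → m < n → 2 ≤ m → PrimeDivisor m) → 2 ≤ n → PrimeDivisor n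
  step (suc k) IH 2≤n with prime? (suc k)
  ... | yes pr = k , pr , ∣-refl
  ... | no ¬pr with ¬prime⇒composite {{ℕ.n>1⇒nonTrivial 2≤n}} ¬pr
  ...   | hasNonTrivialDivisor {divisor = d} {{nt}} d<n d∣n with IH d<n (ℕ.nonTrivial⇒n>1 d {{nt}})
  ...     | j , pr , p∣d = j , pr , ∣-trans p∣d d∣n

isPrime : ℕ → ℤ
isPrime n = when (prime? n) 1ℤ

ε+isPrime : ℕ → ℤ
ε+isPrime n = ε n +ᶻ isPrime n

⋆𝟙≡Σ< : ∀ f n → 1 ≤ n → (f ⋆ 𝟙) n ≡ Σ< n (λ i → when (suc i ∣? n) (f (suc i) *ᶻ 1ℤ))
⋆𝟙≡Σ< f n 1≤n = trans (sym (dirichlet≡⋆ f 𝟙 n 1≤n)) (dirichlet≡Σ< f 𝟙 n)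

-- The divisors of n counted by ε + isPrime are 1 and its ω(n) prime divisors.
g≡[ε+isPrime]⋆𝟙 : ∀ n → 1 ≤ n → (ε+isPrime ⋆ 𝟙) n ≡ g n
g≡[ε+isPrime]⋆𝟙 n 1≤n = begin
  (ε+isPrime ⋆ 𝟙) n
    ≡⟨ ⋆𝟙≡Σ< ε+isPrime n 1≤n ⟩
  Σ< n (λ i → when (suc i ∣? n) ((ε (suc i) +ᶻ isPrime (suc i)) *ᶻ 1ℤ))
    ≡⟨ Σ<-cong n (λ i _ → split i) ⟩
  Σ< n (λ i → when (i ≟ 0) 1ℤ +ᶻ when (prime? (suc i) ×-dec suc i ∣? n) 1ℤ)
    ≡⟨ Σ<-distrib-+ n _ _ ⟩
  Σ< n (λ i → when (i ≟ 0) 1ℤ) +ᶻ Σ< n (λ i → when (prime? (suc i) ×-dec suc i ∣? n) 1ℤ)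
    ≡⟨ cong₂ _+ᶻ_ (trans (Σ<-δ n 0 (λ _ → 1ℤ)) (when-yes 1≤n (0 <? n)))
                  (sym (count-range1 (λ p → prime? p ×-dec p ∣? n) n)) ⟩
  1ℤ +ᶻ + ω n
    ≡⟨ trans (ℤP.+-comm 1ℤ (+ ω n)) (sym (ℤP.pos-+ (ω n) 1)) ⟩
  g n ∎
  where
  open ≡-Reasoning
  divisor-1 : ∀ i → when (suc i ∣? n) (ε (suc i)) ≡ when (i ≟ 0) 1ℤ
  divisor-1 zero    = when-yes (1∣ n) (1 ∣? n)
  divisor-1 (suc _) = when-zero (suc (suc _) ∣? n)
  split : ∀ i → when (suc i ∣? n) ((ε (suc i) +ᶻ isPrime (suc i)) *ᶻ 1ℤ)
              ≡ when (i ≟ 0) 1ℤ +ᶻ when (prime? (suc i) ×-dec suc i ∣? n) 1ℤ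
  split i = begin
    when (suc i ∣? n) ((ε (suc i) +ᶻ isPrime (suc i)) *ᶻ 1ℤ)
      ≡⟨ trans (cong (when (suc i ∣? n)) (ℤP.*-identityʳ _)) (when-+ (suc i ∣? n) _ _) ⟩
    when (suc i ∣? n) (ε (suc i)) +ᶻ when (suc i ∣? n) (isPrime (suc i))
      ≡⟨ cong₂ _+ᶻ_ (divisor-1 i) (trans (when-comm (suc i ∣? n) (prime? (suc i)) 1ℤ)
                                         (sym (when-× (prime? (suc i)) (suc i ∣? n) 1ℤ))) ⟩
    when (i ≟ 0) 1ℤ +ᶻ when (prime? (suc i) ×-dec suc i ∣? n) 1ℤ ∎

-1^n≡±1 : ∀ n → -1ℤ ℤ.^ n ≡ 1ℤ ⊎ -1ℤ ℤ.^ n ≡ -1ℤ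
-1^n≡±1 zero    = inj₁ refl
-1^n≡±1 (suc n) with -1^n≡±1 n
... | inj₁ ≡1  = inj₂ (cong (-1ℤ *ᶻ_) ≡1)
... | inj₂ ≡-1 = inj₁ (cong (-1ℤ *ᶻ_) ≡-1)

1≤s*x⇒sgn[x]≡s : ∀ s x → s ≡ 1ℤ ⊎ s ≡ -1ℤ → 1ℤ ≤ᶻ s *ᶻ x → sgn x ≡ s
1≤s*x⇒sgn[x]≡s _ (+ zero)  (inj₁ refl) (+≤+ ())
1≤s*x⇒sgn[x]≡s _ +[1+ _ ]  (inj₁ refl) _  = refl
1≤s*x⇒sgn[x]≡s _ -[1+ _ ]  (inj₁ refl) ()
1≤s*x⇒sgn[x]≡s _ x         (inj₂ refl) 1≤-x = negative (subst (1ℤ ≤ᶻ_) (ℤP.-1*i≡-i x) 1≤-x)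
  where
  negative : ∀ {x} → 1ℤ ≤ᶻ -ᶻ x → sgn x ≡ -1ℤ
  negative {+ zero}  (+≤+ ())
  negative {+[1+ _ ]} ()
  negative { -[1+ _ ]} _ = refl

unitε≡ε : ∀ n → unitε n ≡ ε n
unitε≡ε zero          = refl
unitε≡ε (suc zero)    = refl
unitε≡ε (suc (suc n)) = refl

-x*-y≡x*y : ∀ x y → -ᶻ x *ᶻ -ᶻ y ≡ x *ᶻ y
-x*-y≡x*y = solve-∀

x≡[x+s]-s : ∀ x s → x ≡ (x +ᶻ s) +ᶻ -ᶻ s
x≡[x+s]-s = solve-∀

module _ (ginv : ℕ → ℤ) (ginv-inverse : IsDirichletInverse g ginv) where

  μ : ℕ → ℤ
  μ = ginv ⋆ ε+isPrime

  μ⋆𝟙≡ε : ∀ n → 1 ≤ n → (μ ⋆ 𝟙) n ≡ ε n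
  μ⋆𝟙≡ε n 1≤n = begin
    (ginv ⋆ ε+isPrime ⋆ 𝟙) n   ≡⟨ ⋆-assoc ginv ε+isPrime 𝟙 n 1≤n ⟩
    (ginv ⋆ (ε+isPrime ⋆ 𝟙)) n ≡⟨ ⋆-congʳ ginv n 1≤n (λ b 1≤b _ → g≡[ε+isPrime]⋆𝟙 b 1≤b) ⟩
    (ginv ⋆ g) n               ≡⟨ ⋆-comm ginv g n ⟩
    (g ⋆ ginv) n               ≡⟨ sym (dirichlet≡⋆ g ginv n 1≤n) ⟩
    dirichlet g ginv n         ≡⟨ ginv-inverse n 1≤n ⟩
    unitε n                    ≡⟨ unitε≡ε n ⟩
    ε n                        ∎
    where open ≡-Reasoning

  μ[1]≡1 : μ 1 ≡ 1ℤ
  μ[1]≡1 = begin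
    μ 1                                          ≡⟨ sym (ℤP.*-identityʳ (μ 1)) ⟩
    μ 1 *ᶻ 1ℤ                                    ≡⟨ sym (when-yes (1∣ 1) (1 ∣? 1)) ⟩
    when (1 ∣? 1) (μ 1 *ᶻ 1ℤ)                    ≡⟨ sym (ℤP.+-identityˡ _) ⟩
    Σ< 1 (λ i → when (suc i ∣? 1) (μ (suc i) *ᶻ 1ℤ)) ≡⟨ sym (⋆𝟙≡Σ< μ 1 ℕP.≤-refl) ⟩
    (μ ⋆ 𝟙) 1                                    ≡⟨ μ⋆𝟙≡ε 1 ℕP.≤-refl ⟩
    1ℤ                                           ∎
    where open ≡-Reasoning

  0≤λ·μ : ∀ n → 1 ≤ n → 0ℤ ≤ᶻ liouville n *ᶻ μ n
  0≤λ·μ = <-rec (λ n → 1 ≤ n → 0ℤ ≤ᶻ liouville n *ᶻ μ n) step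
    where
    step : ∀ n → (∀ {m} → m < n → 1 ≤ m → 0ℤ ≤ᶻ liouville m *ᶻ μ m) → 1 ≤ n → 0ℤ ≤ᶻ liouville n *ᶻ μ n
    step (suc zero) IH _ = subst (λ x → 0ℤ ≤ᶻ liouville 1 *ᶻ x) (sym μ[1]≡1) (+≤+ z≤n)
    step n@(suc (suc _)) IH 1≤n with ∃prime∣ n (s≤s (s≤s z≤n))
    ... | j , pr , p∣n with PrimeFactor.P∣⇒μ≡0⊎μ≡-μ[/P] j pr μ μ⋆𝟙≡ε n 1≤n p∣n
    ...   | inj₁ μn≡0 = subst (0ℤ ≤ᶻ_) (sym (trans (cong (liouville n *ᶻ_) μn≡0) (ℤP.*-zeroʳ (liouville n)))) (+≤+ z≤n)
    ...   | inj₂ μn≡-μ[n/p] = subst (0ℤ ≤ᶻ_) (sym λμ≡) (uncurry (flip IH) (quotient-bounds 1≤n p∣n (prime⇒2≤ pr)))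
      where
      λμ≡ : liouville n *ᶻ μ n ≡ liouville (n / suc j) *ᶻ μ (n / suc j)
      λμ≡ = trans (cong₂ _*ᶻ_ (liouville-/prime pr n 1≤n p∣n) μn≡-μ[n/p]) (-x*-y≡x*y (liouville (n / suc j)) (μ (n / suc j)))

  primeDivisorTerm : ℕ → ℕ → ℤ
  primeDivisorTerm n i = when (suc i ∣? n) (isPrime (suc i) *ᶻ (liouville (n / suc i) *ᶻ ginv (n / suc i)))

  λ·ginv≡λ·μ+Σ : ∀ n → 1 ≤ n → liouville n *ᶻ ginv n ≡ liouville n *ᶻ μ n +ᶻ Σ< n (primeDivisorTerm n)
  λ·ginv≡λ·μ+Σ n 1≤n = begin
    l *ᶻ ginv n
      ≡⟨ x≡[x+s]-s (l *ᶻ ginv n) (l *ᶻ S) ⟩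
    (l *ᶻ ginv n +ᶻ l *ᶻ S) +ᶻ -ᶻ (l *ᶻ S)
      ≡⟨ cong₂ _+ᶻ_ (trans (sym (ℤP.*-distribˡ-+ l (ginv n) S)) (cong (l *ᶻ_) (sym μ≡ginv+S))) negate ⟩
    l *ᶻ μ n +ᶻ Σ< n (primeDivisorTerm n) ∎
    where
    open ≡-Reasoning
    l = liouville n
    term : ℕ → ℤ
    term i = when (suc i ∣? n) (isPrime (suc i) *ᶻ ginv (n / suc i))
    S = Σ< n term
    μ≡ginv+S : μ n ≡ ginv n +ᶻ S
    μ≡ginv+S = trans (⋆-distribˡ-+ ginv ε isPrime n)
      (cong₂ _+ᶻ_ (⋆-identityʳ ginv n 1≤n)
                  (trans (⋆-comm ginv isPrime n) (trans (sym (dirichlet≡⋆ isPrime ginv n 1≤n)) (dirichlet≡Σ< isPrime ginv n))))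
    negate-prime : ∀ i → suc i ∣ n → (d : Dec (Prime (suc i))) →
                   -ᶻ (l *ᶻ (when d 1ℤ *ᶻ ginv (n / suc i))) ≡ when d 1ℤ *ᶻ (liouville (n / suc i) *ᶻ ginv (n / suc i))
    negate-prime i i∣n (yes pr) = begin
      -ᶻ (l *ᶻ (1ℤ *ᶻ ginv (n / suc i)))                 ≡⟨ cong (λ x → -ᶻ (l *ᶻ x)) (ℤP.*-identityˡ _) ⟩
      -ᶻ (l *ᶻ ginv (n / suc i))                         ≡⟨ cong (λ x → -ᶻ (x *ᶻ ginv (n / suc i))) (liouville-/prime pr n 1≤n i∣n) ⟩
      -ᶻ (-ᶻ liouville (n / suc i) *ᶻ ginv (n / suc i))  ≡⟨ cong -ᶻ_ (sym (ℤP.neg-distribˡ-* (liouville (n / suc i)) (ginv (n / suc i)))) ⟩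
      -ᶻ -ᶻ (liouville (n / suc i) *ᶻ ginv (n / suc i))  ≡⟨ ℤP.neg-involutive _ ⟩
      liouville (n / suc i) *ᶻ ginv (n / suc i)          ≡⟨ sym (ℤP.*-identityˡ _) ⟩
      1ℤ *ᶻ (liouville (n / suc i) *ᶻ ginv (n / suc i))  ∎
    negate-prime i i∣n (no _) = cong -ᶻ_ (ℤP.*-zeroʳ l)
    negate : -ᶻ (l *ᶻ S) ≡ Σ< n (primeDivisorTerm n)
    negate = begin
      -ᶻ (l *ᶻ S)                        ≡⟨ cong -ᶻ_ (*-distribˡ-Σ< n l term) ⟩
      -ᶻ Σ< n (λ i → l *ᶻ term i)        ≡⟨ sym (Σ<-neg n _) ⟩
      Σ< n (λ i → -ᶻ (l *ᶻ term i))      ≡⟨ Σ<-cong n (λ i _ →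
                                              trans (cong -ᶻ_ (when-*ˡ (suc i ∣? n) _ l))
                                              (trans (sym (when-neg (suc i ∣? n) _))
                                                     (when-cong (suc i ∣? n) (λ i∣n → negate-prime i i∣n (prime? (suc i)))))) ⟩
      Σ< n (primeDivisorTerm n)          ∎

  1≤λ·ginv : ∀ n → 1 ≤ n → 1ℤ ≤ᶻ liouville n *ᶻ ginv n
  1≤λ·ginv = <-rec (λ n → 1 ≤ n → 1ℤ ≤ᶻ liouville n *ᶻ ginv n) step
    where
    step : ∀ n → (∀ {m} → m < n → 1 ≤ m → 1ℤ ≤ᶻ liouville m *ᶻ ginv m) → 1 ≤ n → 1ℤ ≤ᶻ liouville n *ᶻ ginv n
    step n IH 1≤n = subst (1ℤ ≤ᶻ_) (sym (λ·ginv≡λ·μ+Σ n 1≤n)) (bound (n ≟ 1))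
      where
      IH-at-quotient : ∀ i → suc i ∣ n → Prime (suc i) → 1ℤ ≤ᶻ 1ℤ *ᶻ (liouville (n / suc i) *ᶻ ginv (n / suc i))
      IH-at-quotient i i∣n pr = subst (1ℤ ≤ᶻ_) (sym (ℤP.*-identityˡ (liouville (n / suc i) *ᶻ ginv (n / suc i))))
                                      (uncurry (flip IH) (quotient-bounds 1≤n i∣n (prime⇒2≤ pr)))
      term≥1 : ∀ i → suc i ∣ n → Prime (suc i) → 1ℤ ≤ᶻ primeDivisorTerm n i
      term≥1 i i∣n pr = subst (1ℤ ≤ᶻ_)
        (sym (trans (when-yes i∣n (suc i ∣? n))
                    (cong (_*ᶻ (liouville (n / suc i) *ᶻ ginv (n / suc i))) (when-yes pr (prime? (suc i))))))
                              (IH-at-quotient i i∣n pr)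
      term≥0 : ∀ i → i < n → 0ℤ ≤ᶻ primeDivisorTerm n i
      term≥0 i _ = when-nonNeg (suc i ∣? n) λ i∣n → by-primality i∣n (prime? (suc i))
        where
        by-primality : suc i ∣ n → (d : Dec (Prime (suc i))) → 0ℤ ≤ᶻ when d 1ℤ *ᶻ (liouville (n / suc i) *ᶻ ginv (n / suc i))
        by-primality i∣n (yes pr) = ℤP.≤-trans (+≤+ z≤n) (IH-at-quotient i i∣n pr)
        by-primality i∣n (no _)   = +≤+ z≤n
      bound : Dec (n ≡ 1) → 1ℤ ≤ᶻ liouville n *ᶻ μ n +ᶻ Σ< n (primeDivisorTerm n)
      bound (yes refl) = subst (λ x → 1ℤ ≤ᶻ liouville 1 *ᶻ x +ᶻ Σ< 1 (primeDivisorTerm 1)) (sym μ[1]≡1)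
                               (ℤP.+-mono-≤ (ℤP.≤-refl {1ℤ}) (Σ<-nonNeg 1 _ term≥0))
      bound (no n≢1) with ∃prime∣ n (ℕP.≤∧≢⇒< 1≤n (n≢1 ∘ sym))
      ... | j , pr , p∣n = ℤP.+-mono-≤ (0≤λ·μ n 1≤n)
                             (ℤP.≤-trans (term≥1 j p∣n pr) (term≤Σ< n j _ (∣⇒≤ {{ℕ.>-nonZero 1≤n}} p∣n) term≥0))

proposition2p1 : (ginv : ℕ → ℤ) → IsDirichletInverse g ginv →
    ∀ n → 1 ≤ n → sgn (ginv n) ≡ liouville n
proposition2p1 ginv ginv-inverse n 1≤n =
  1≤s*x⇒sgn[x]≡s (liouville n) (ginv n) (-1^n≡±1 (Ω n)) (1≤λ·ginv ginv ginv-inverse n 1≤n)
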